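{- Let $L(n)=\sum_{d\mid n}\bigl|\mathrm{cycles}^{(1)}(d)\bigr|$ (the total number of 1-cycles). Then $\dfrac{L(n)}{(n-2)!}\to 1$ as $n\to\infty$.
   Context: Let $\sigma\in S_n$ be $\sigma(i)=i+1$ for $i<n$, $\sigma(n)=1$. For $\pi\in S_n$ let $\mathrm{inc}(\pi)=\{\sigma^k\circ\pi:0\le k\le n-1\}$; these sets are the classes of an equivalence relation on $S_n$ with $(n-1)!$ classes. The map $f(\mathrm{inc}(\pi))=\mathrm{inc}(\pi\circ\sigma)$ is a well-defined permutation of the set of classes. A 1-cycle is an orbit of $f$ (a class fixed by $f$ is a 1-cycle of length 1); $\mathrm{cycles}^{(1)}(d)$ is the set of 1-cycles consisting of exactly $d$ classes. -}

module Defs where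

open import Data.Nat using (ℕ; zero; suc; _∸_; _≟_; _!)
open import Data.Nat.Properties using (_!≢0)
open import Data.Nat.Divisibility using (_∣?_)
open import Data.Nat.DivMod using (_mod_)
open import Data.Fin using (Fin; toℕ)
open import Data.Fin.Properties using (all?; any?) renaming (_≟_ to _≟F_)
open import Data.Vec using (Vec; []; _∷_; lookup; tabulate)
open import Data.Vec.Properties using (≡-dec)
open import Data.List using (List; []; _∷_; [_]; map; filter; length;
  allFin; cartesianProductWith; deduplicate; applyUpTo)
open import Data.Nat.ListAction using (sum)
open import Data.Integer using (+_)
open import Data.Rational using (ℚ; _/_)
open import Data.Product using (∃; ∃-syntax)
open import Relation.Binary.PropositionalEquality using (_≡_)
open import Relation.Nullary using (Dec)
open import Relation.Nullary.Decidable using (_→-dec_)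

-- A permutation of Fin n in one-line notation: π is represented by the
-- vector (π(0), …, π(n-1)).
Vecs : ℕ → Set
Vecs n = Vec (Fin n) n

allVecs : (n k : ℕ) → List (Vec (Fin n) k)
allVecs n zero    = [ [] ]
allVecs n (suc k) = cartesianProductWith _∷_ (allFin n) (allVecs n k)

-- the map i ↦ π(i) is injective (equivalently bijective, Fin n being finite)
IsPerm : ∀ {n} → Vecs n → Set
IsPerm {n} π = ∀ (i j : Fin n) → lookup π i ≡ lookup π j → i ≡ j

isPerm? : ∀ {n} (π : Vecs n) → Dec (IsPerm π)
isPerm? π = all? λ i → all? λ j → (lookup π i ≟F lookup π j) →-dec (i ≟F j)

Sym : (n : ℕ) → List (Vecs n)
Sym n = filter isPerm? (allVecs n n)

_∘ₚ_ : ∀ {n} → Vecs n → Vecs n → Vecs n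
π ∘ₚ τ = tabulate λ i → lookup π (lookup τ i)

-- σ(i) = i+1 for i < n, σ(n) = 1  (0-indexed: i ↦ i+1 mod n)
σfun : ∀ {n} → Fin n → Fin n
σfun {suc m} i = suc (toℕ i) mod suc m

σ : ∀ {n} → Vecs n
σ = tabulate σfun

idₚ : ∀ {n} → Vecs n
idₚ = tabulate λ i → i

σ^ : ∀ {n} → ℕ → Vecs n
σ^ zero    = idₚ
σ^ (suc k) = σ ∘ₚ σ^ k

-- inc(π) = inc(π')  iff  π' ∈ inc(π) = {σ^k ∘ π : 0 ≤ k ≤ n-1}
SameClass : ∀ {n} → Vecs n → Vecs n → Set
SameClass {n} π π′ = ∃[ k ] (π′ ≡ σ^ {n} (toℕ {n} k) ∘ₚ π)

sameClass? : ∀ {n} (π π′ : Vecs n) → Dec (SameClass π π′)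
sameClass? {n} π π′ = any? λ k → ≡-dec _≟F_ π′ (σ^ (toℕ k) ∘ₚ π)

-- one representative for each class inc(π); the set of classes
classReps : (n : ℕ) → List (Vecs n)
classReps n = deduplicate sameClass? (Sym n)

-- f^j(inc(π)) = inc(π ∘ σ^j).  Since f^n = id, the f-orbit of inc(π) is
-- {inc(π ∘ σ^j) : 0 ≤ j ≤ n-1}.
SameOrbit : ∀ {n} → Vecs n → Vecs n → Set
SameOrbit {n} π π′ = ∃[ j ] SameClass π′ (π ∘ₚ σ^ {n} (toℕ {n} j))

sameOrbit? : ∀ {n} (π π′ : Vecs n) → Dec (SameOrbit π π′)
sameOrbit? {n} π π′ = any? λ j → sameClass? π′ (π ∘ₚ σ^ (toℕ j))

-- number of classes in the f-orbit (1-cycle) of inc(π)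
orbitSize : ∀ {n} → Vecs n → ℕ
orbitSize {n} π =
  length (deduplicate sameClass? (map (λ j → π ∘ₚ σ^ (toℕ j)) (allFin n)))

-- one representative permutation for each 1-cycle (orbit of f)
orbitReps : (n : ℕ) → List (Vecs n)
orbitReps n = deduplicate sameOrbit? (classReps n)

cycles1 : (n d : ℕ) → ℕ
cycles1 n d = length (filter (λ π → orbitSize π ≟ d) (orbitReps n))

L : ℕ → ℕ
L n = sum (map (cycles1 n) (filter (_∣? n) (applyUpTo suc n)))

ratio : ℕ → ℚ
ratio n = _/_ (+ L n) ((n ∸ 2) !) {{(n ∸ 2) !≢0}}

-- Write N = n and let ℤ_N × ℤ_N act on S_N by (a , b) · π = σ^a ∘ π ∘ σ^b.  A class
-- inc(π) is an orbit of the first factor, and the f-orbit of inc(π) consists of the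
-- classes met by the full orbit of π, so the 1-cycles correspond to the full orbits
-- and L(N) lies between the number of free orbits and the number of all orbits.
-- Every orbit has at most N² elements and a free one exactly N², which makes a free
-- orbit a 1-cycle of N classes.  Hence N² L(N) is N! up to N² times the number of
-- non-free permutations.  A non-free π satisfies π(j + d) = π(j) + e for some
-- 1 ≤ d ≤ ⌊N/2⌋, so it is determined by (d, e) and its first ⌊N/2⌋ values: there are
-- at most ⌊N/2⌋ N N!/⌈N/2⌉! of them, which is o((N-2)!) since ⌈N/2⌉! outgrows any
-- polynomial.  As N!/N² = (N-2)! (N-1)/N, this gives L(N)/(N-2)! → 1.

module Submission where

open import Defs

-- Everything except the theorem lives in this module, so that Data.Nat's _<_ is not
-- in scope where the statement below uses the order on ℚ.
module OneCycles where

  open import Data.Nat using (ℕ; zero; suc; _+_; _*_; _∸_; _≤_; _<_; _!; _≟_; _≤?_; _<?_; z≤n; s≤s; ⌊_/2⌋; ⌈_/2⌉; ∣_-_∣; NonZero)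
  open import Data.Nat.Properties
  open import Data.Nat.DivMod using (_%_; _mod_; %-distribˡ-+; m%n%n≡m%n; m%n<n; m<n⇒m%n≡m; m%n≤n; n%n≡0)
  open import Data.Nat.Divisibility using (_∣?_; ∣-refl)
  open import Data.Nat.ListAction using (sum)
  open import Data.Nat.Tactic.RingSolver using (solve-∀)
  open import Algebra.Properties.CommutativeSemigroup +-commutativeSemigroup using (interchange)
  open import Data.Integer as ℤ using (-[1+_]; +[1+_]; _⊖_)
  import Data.Integer.Properties as ℤ
  open import Data.Rational as ℚ using (ℚ; mkℚ; 0ℚ; 1ℚ; ↧ₙ_; toℚᵘ; *<*)
  open import Data.Rational.Properties using (toℚᵘ-cancel-<; toℚᵘ-homo-∣-∣; toℚᵘ-homo-+; toℚᵘ-homo‿-; toℚᵘ-fromℚᵘ)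
  import Data.Rational.Unnormalised as ℚᵘ
  import Data.Rational.Unnormalised.Properties as ℚᵘ
  open import Data.Fin using (Fin; toℕ; zero; suc; fromℕ<; inject≤; punchIn; punchOut)
  open import Data.Fin.Properties
    using (all?; any?; toℕ-injective; toℕ<n; toℕ-fromℕ<; toℕ-inject≤; punchIn-injective; punchInᵢ≢i; punchIn-punchOut)
    renaming (_≟_ to _≟ᶠ_; suc-injective to suc-injectiveᶠ)
  open import Data.Vec using (Vec; []; _∷_; lookup; tabulate)
  import Data.Vec as Vec
  open import Data.Vec.Properties using (lookup∘tabulate; tabulate∘lookup; tabulate-cong; lookup-map; ∷-injective; ≡-dec)
  open import Data.List
    using (List; []; _∷_; [_]; _++_; map; filter; length; concat; allFin; applyUpTo; cartesianProduct; cartesianProductWith; deduplicate)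
  open import Data.List.Properties
    using (length-removeAt′; filter-all; filter-none; filter-++; map-cong-local; length-++; length-map; length-tabulate; length-applyUpTo)
  open import Data.List.Membership.Propositional using (_∈_; find; lose)
  open import Data.List.Membership.Propositional.Properties
    using (∈-filter⁻; ∈-filter⁺; ∈-map⁺; ∈-map⁻; ∈-allFin; ∈-cartesianProductWith⁺; ∈-cartesianProduct⁺; ∈-cartesianProduct⁻;
           ∈-applyUpTo⁺; ∈-applyUpTo⁻; ∈-concat⁺′)
  open import Data.List.Relation.Unary.Any as Any using (Any; here; there; index; _─_)
  open import Data.List.Relation.Unary.Any.Properties using (deduplicate⁺; deduplicate⁻)
  import Data.List.Relation.Unary.All as All
  open import Data.List.Relation.Unary.All.Properties using (all-filter)
  open import Data.List.Relation.Unary.AllPairs using (AllPairs; []; _∷_)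
  import Data.List.Relation.Unary.AllPairs as AllPairs
  import Data.List.Relation.Unary.AllPairs.Properties as AllPairs
  open import Data.List.Relation.Unary.Unique.Propositional using (Unique)
  import Data.List.Relation.Unary.Unique.Propositional.Properties as Unique
  open import Data.List.Relation.Binary.Subset.Propositional using (_⊆_)
  open import Data.Product using (∃; ∃₂; _×_; _,_; proj₁; proj₂)
  import Data.Product.Properties as Product
  open import Data.Sum using (inj₁; inj₂)
  open import Data.Empty using (⊥-elim)
  open import Function using (_∘_; _∘′_; id)
  open import Level using (0ℓ)
  open import Relation.Nullary using (Dec; yes; no; ¬_; ¬?)
  open import Relation.Nullary.Decidable using (_×-dec_; _→-dec_)
  open import Relation.Unary using (Pred; Decidable)
  open import Relation.Unary.Properties using (∁?)
  open import Relation.Binary.PropositionalEquality hiding ([_])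

  private
    variable
      A B C : Set

  -- Counting in lists

  ∈-─ : ∀ {x z : A} {ys} (x∈ys : x ∈ ys) → z ∈ ys → z ≢ x → z ∈ (ys ─ x∈ys)
  ∈-─ (here refl)  (here refl)  z≢x = ⊥-elim (z≢x refl)
  ∈-─ (here refl)  (there z∈ys) _   = z∈ys
  ∈-─ (there _)    (here refl)  _   = here refl
  ∈-─ (there x∈ys) (there z∈ys) z≢x = there (∈-─ x∈ys z∈ys z≢x)

  length-≤-injectiveOn : ∀ (f : A → B) {xs ys} → Unique xs →
    (∀ {a b} → a ∈ xs → b ∈ xs → f a ≡ f b → a ≡ b) →
    (∀ {a} → a ∈ xs → f a ∈ ys) → length xs ≤ length ys
  length-≤-injectiveOn f {[]}     _             _   _    = z≤n
  length-≤-injectiveOn f {x ∷ xs} {ys} (x∉xs ∷ xs!) inj maps = begin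
    suc (length xs)           ≤⟨ s≤s (length-≤-injectiveOn f xs! (λ a b → inj (there a) (there b)) maps′) ⟩
    suc (length (ys ─ fx∈ys)) ≡⟨ length-removeAt′ ys (index fx∈ys) ⟨
    length ys                 ∎
    where
    open ≤-Reasoning
    fx∈ys = maps (here refl)
    maps′ : ∀ {a} → a ∈ xs → f a ∈ (ys ─ fx∈ys)
    maps′ a∈xs = ∈-─ fx∈ys (maps (there a∈xs))
      (λ fa≡fx → All.lookup x∉xs a∈xs (sym (inj (there a∈xs) (here refl) fa≡fx)))

  length-≤-⊆ : ∀ {xs ys : List A} → Unique xs → xs ⊆ ys → length xs ≤ length ys
  length-≤-⊆ xs! xs⊆ys = length-≤-injectiveOn id xs! (λ _ _ → id) xs⊆ys

  length-filter-mono : ∀ {P Q : Pred A 0ℓ} (P? : Decidable P) (Q? : Decidable Q) →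
    (∀ {x} → P x → Q x) → ∀ xs → length (filter P? xs) ≤ length (filter Q? xs)
  length-filter-mono P? Q? P⇒Q []       = z≤n
  length-filter-mono P? Q? P⇒Q (x ∷ xs) with P? x | Q? x
  ... | yes _  | yes _  = s≤s (length-filter-mono P? Q? P⇒Q xs)
  ... | yes px | no ¬qx = ⊥-elim (¬qx (P⇒Q px))
  ... | no _   | yes _  = m≤n⇒m≤1+n (length-filter-mono P? Q? P⇒Q xs)
  ... | no _   | no _   = length-filter-mono P? Q? P⇒Q xs

  length-filter+length-filter-∁ : ∀ {P : Pred A 0ℓ} (P? : Decidable P) xs →
    length (filter P? xs) + length (filter (∁? P?) xs) ≡ length xs
  length-filter+length-filter-∁ P? []       = refl
  length-filter+length-filter-∁ P? (x ∷ xs) with P? x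
  ... | yes _ = cong suc (length-filter+length-filter-∁ P? xs)
  ... | no _  = trans (+-suc _ _) (cong suc (length-filter+length-filter-∁ P? xs))

  length-filter-∷ : ∀ {P : Pred A 0ℓ} (P? : Decidable P) x xs →
    length (filter P? (x ∷ xs)) ≡ length (filter P? [ x ]) + length (filter P? xs)
  length-filter-∷ P? x xs with P? x
  ... | yes _ = refl
  ... | no _  = refl

  length-filter≡1 : ∀ {P : Pred A 0ℓ} (P? : Decidable P) {xs} → Any P xs →
    AllPairs (λ a b → ¬ (P a × P b)) xs → length (filter P? xs) ≡ 1
  length-filter≡1 P? {x ∷ xs} (here px) (x-excl ∷ _) with P? x
  ... | no ¬px = ⊥-elim (¬px px)
  ... | yes _  = cong (suc ∘ length) (filter-none P? (All.map (λ excl py → excl (px , py)) x-excl))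
  length-filter≡1 P? {x ∷ xs} (there any) (x-excl ∷ xs-excl) with P? x
  ... | no _  = length-filter≡1 P? any xs-excl
  ... | yes px with find any
  ...   | _ , y∈xs , py = ⊥-elim (All.lookup x-excl y∈xs (px , py))

  length-filter-map : ∀ {P : Pred B 0ℓ} (P? : Decidable P) (f : A → B) xs →
    length (filter P? (map f xs)) ≡ length (filter (P? ∘ f) xs)
  length-filter-map P? f []       = refl
  length-filter-map P? f (x ∷ xs) with P? (f x)
  ... | yes _ = cong suc (length-filter-map P? f xs)
  ... | no _  = length-filter-map P? f xs

  length-cartesianProductWith : ∀ (f : A → B → C) xs ys →
    length (cartesianProductWith f xs ys) ≡ length xs * length ys
  length-cartesianProductWith f []       ys = refl
  length-cartesianProductWith f (x ∷ xs) ys =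
    trans (length-++ (map (f x) ys)) (cong₂ _+_ (length-map (f x) ys) (length-cartesianProductWith f xs ys))

  sum-map-const : ∀ k (xs : List A) → sum (map (λ _ → k) xs) ≡ k * length xs
  sum-map-const k []       = sym (*-zeroʳ k)
  sum-map-const k (x ∷ xs) = trans (cong (k +_) (sum-map-const k xs)) (sym (*-suc k _))

  sum-map-cong : ∀ (f g : A → ℕ) xs → (∀ {x} → x ∈ xs → f x ≡ g x) → sum (map f xs) ≡ sum (map g xs)
  sum-map-cong f g xs f≡g = cong sum (map-cong-local (All.tabulate f≡g))

  sum-map-mono : ∀ (f g : A → ℕ) xs → (∀ {x} → x ∈ xs → f x ≤ g x) → sum (map f xs) ≤ sum (map g xs)
  sum-map-mono f g []       _   = z≤n
  sum-map-mono f g (x ∷ xs) f≤g = +-mono-≤ (f≤g (here refl)) (sum-map-mono f g xs (f≤g ∘ there))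

  sum-map-+ : ∀ (f g : A → ℕ) xs → sum (map (λ x → f x + g x) xs) ≡ sum (map f xs) + sum (map g xs)
  sum-map-+ f g []       = refl
  sum-map-+ f g (x ∷ xs) =
    trans (cong (f x + g x +_) (sum-map-+ f g xs)) (interchange (f x) (g x) (sum (map f xs)) (sum (map g xs)))

  ≤-sum-map : ∀ (f : A → ℕ) {x} xs → x ∈ xs → f x ≤ sum (map f xs)
  ≤-sum-map f (y ∷ xs) (here refl)  = m≤m+n (f y) _
  ≤-sum-map f (y ∷ xs) (there x∈xs) = ≤-trans (≤-sum-map f xs x∈xs) (m≤n+m _ (f y))

  *-length-filter-≤-sum : ∀ {P : Pred A 0ℓ} (P? : Decidable P) (f : A → ℕ) k xs →
    (∀ {x} → x ∈ xs → P x → k ≤ f x) → k * length (filter P? xs) ≤ sum (map f xs)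
  *-length-filter-≤-sum P? f k []       _   = ≤-reflexive (*-zeroʳ k)
  *-length-filter-≤-sum P? f k (x ∷ xs) k≤f with P? x
  ... | yes px = ≤-trans (≤-reflexive (*-suc k _))
                   (+-mono-≤ (k≤f (here refl) px) (*-length-filter-≤-sum P? f k xs (k≤f ∘ there)))
  ... | no _   = ≤-trans (*-length-filter-≤-sum P? f k xs (k≤f ∘ there)) (m≤n+m _ (f x))

  length-concat-map : ∀ (f : A → List B) xs → length (concat (map f xs)) ≡ sum (map (length ∘ f) xs)
  length-concat-map f []       = refl
  length-concat-map f (x ∷ xs) = trans (length-++ (f x)) (cong (length (f x) +_) (length-concat-map f xs))

  length-filter-cartesianProductWith : ∀ {P : Pred C 0ℓ} (P? : Decidable P) (f : A → B → C) xs ys →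
    length (filter P? (cartesianProductWith f xs ys)) ≡ sum (map (λ x → length (filter (P? ∘ f x) ys)) xs)
  length-filter-cartesianProductWith P? f []       ys = refl
  length-filter-cartesianProductWith P? f (x ∷ xs) ys = begin
    length (filter P? (map (f x) ys ++ cartesianProductWith f xs ys))
      ≡⟨ cong length (filter-++ P? (map (f x) ys) _) ⟩
    length (filter P? (map (f x) ys) ++ filter P? (cartesianProductWith f xs ys))
      ≡⟨ length-++ (filter P? (map (f x) ys)) ⟩
    length (filter P? (map (f x) ys)) + length (filter P? (cartesianProductWith f xs ys))
      ≡⟨ cong₂ _+_ (length-filter-map P? (f x) ys) (length-filter-cartesianProductWith P? f xs ys) ⟩
    length (filter (P? ∘ f x) ys) + sum (map (λ x → length (filter (P? ∘ f x) ys)) xs) ∎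
    where open ≡-Reasoning

  module _ {Q : A → B → Set} (Q? : ∀ a b → Dec (Q a b)) where

    sum-length-filter-comm : ∀ as bs →
      sum (map (λ a → length (filter (Q? a) bs)) as) ≡ sum (map (λ b → length (filter (λ a → Q? a b) as)) bs)
    sum-length-filter-comm as []       = sum-map-const 0 as
    sum-length-filter-comm as (b ∷ bs) = begin
      sum (map (λ a → length (filter (Q? a) (b ∷ bs))) as)
        ≡⟨ sum-map-cong _ _ as (λ {a} _ → length-filter-∷ (Q? a) b bs) ⟩
      sum (map (λ a → length (filter (Q? a) [ b ]) + length (filter (Q? a) bs)) as)
        ≡⟨ sum-map-+ _ _ as ⟩
      sum (map (λ a → length (filter (Q? a) [ b ])) as) + sum (map (λ a → length (filter (Q? a) bs)) as)
        ≡⟨ cong₂ _+_ (column as) (sum-length-filter-comm as bs) ⟩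
      length (filter (λ a → Q? a b) as) + sum (map (λ b → length (filter (λ a → Q? a b) as)) bs) ∎
      where
      open ≡-Reasoning
      transpose : ∀ a → length (filter (Q? a) [ b ]) ≡ length (filter (λ a → Q? a b) [ a ])
      transpose a with Q? a b
      ... | yes _ = refl
      ... | no _  = refl
      column : ∀ as → sum (map (λ a → length (filter (Q? a) [ b ])) as) ≡ length (filter (λ a → Q? a b) as)
      column []       = refl
      column (a ∷ as) = trans (cong₂ _+_ (transpose a) (column as)) (sym (length-filter-∷ (λ a → Q? a b) a as))

  sum-length-fibres-≤ : ∀ (f : A → ℕ) {ds} → Unique ds → ∀ xs →
    sum (map (λ d → length (filter (λ x → f x ≟ d) xs)) ds) ≤ length xs
  sum-length-fibres-≤ f {ds} ds! xs = begin
    sum (map (λ d → length (filter (λ x → f x ≟ d) xs)) ds)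
      ≡⟨ sum-length-filter-comm (λ d x → f x ≟ d) ds xs ⟩
    sum (map (λ x → length (filter (f x ≟_) ds)) xs)
      ≤⟨ sum-map-mono _ (λ _ → 1) xs (λ {x} _ → fibre≤1 x) ⟩
    sum (map (λ _ → 1) xs)  ≡⟨ sum-map-const 1 xs ⟩
    1 * length xs           ≡⟨ *-identityˡ _ ⟩
    length xs               ∎
    where
    open ≤-Reasoning
    fibre≤1 : ∀ x → length (filter (f x ≟_) ds) ≤ 1
    fibre≤1 x = length-≤-⊆ {ys = [ f x ]} (Unique.filter⁺ (f x ≟_) ds!)
      (λ d∈ → here (sym (proj₂ (∈-filter⁻ (f x ≟_) {xs = ds} d∈))))

  module _ {R : A → A → Set} (R? : ∀ x y → Dec (R x y)) where

    deduplicate-pairwise : ∀ xs → AllPairs (λ a b → ¬ R a b) (deduplicate R? xs)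
    deduplicate-pairwise []       = []
    deduplicate-pairwise (x ∷ xs) =
      all-filter (¬? ∘ R? x) (deduplicate R? xs) ∷ AllPairs.filter⁺ (¬? ∘ R? x) (deduplicate-pairwise xs)

    deduplicate-unique : (∀ x → R x x) → ∀ xs → Unique (deduplicate R? xs)
    deduplicate-unique R-refl xs =
      AllPairs.map (λ ¬Rab a≡b → ¬Rab (subst (R _) a≡b (R-refl _))) (deduplicate-pairwise xs)

    deduplicate-id : ∀ {xs} → AllPairs (λ a b → ¬ R a b) xs → deduplicate R? xs ≡ xs
    deduplicate-id {[]}     []             = refl
    deduplicate-id {x ∷ xs} (x-ok ∷ xs-ok) =
      cong (x ∷_) (trans (cong (filter (¬? ∘ R? x)) (deduplicate-id xs-ok)) (filter-all (¬? ∘ R? x) x-ok))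

    deduplicate-covers : (∀ {x y z} → R x y → R y z → R x z) → (∀ x → R x x) →
      ∀ {x xs} → x ∈ xs → ∃ λ y → y ∈ deduplicate R? xs × R y x
    deduplicate-covers R-trans R-refl {x} x∈xs =
      find (deduplicate⁺ R? R-trans (Any.map (λ { refl → R-refl x }) x∈xs))

  ∣m-n∣≤o : ∀ {m n o} → m ≤ n + o → n ≤ m + o → ∣ m - n ∣ ≤ o
  ∣m-n∣≤o {m} {n} {o} m≤n+o n≤m+o with ∣m-n∣≡[m∸n]∨[n∸m] m n
  ... | inj₁ eq = subst (_≤ o) (sym eq) (m≤n+o⇒m∸n≤o m n m≤n+o)
  ... | inj₂ eq = subst (_≤ o) (sym eq) (m≤n+o⇒m∸n≤o n m n≤m+o)

  n≤n! : ∀ n → n ≤ n !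
  n≤n! zero    = z≤n
  n≤n! (suc n) = subst (_≤ suc n * n !) (*-identityʳ (suc n)) (*-monoʳ-≤ (suc n) (1≤n! n))

  ⌈n/2⌉≤1+⌊n/2⌋ : ∀ n → ⌈ n /2⌉ ≤ suc ⌊ n /2⌋
  ⌈n/2⌉≤1+⌊n/2⌋ zero          = z≤n
  ⌈n/2⌉≤1+⌊n/2⌋ (suc zero)    = s≤s z≤n
  ⌈n/2⌉≤1+⌊n/2⌋ (suc (suc n)) = s≤s (⌈n/2⌉≤1+⌊n/2⌋ n)

  -- Injections and permutations

  IsInjection : ∀ {n k} → Vec (Fin n) k → Set
  IsInjection {k = k} v = ∀ (i j : Fin k) → lookup v i ≡ lookup v j → i ≡ j

  isInjection? : ∀ {n k} (v : Vec (Fin n) k) → Dec (IsInjection v)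
  isInjection? v = all? λ i → all? λ j → (lookup v i ≟ᶠ lookup v j) →-dec (i ≟ᶠ j)

  injections : (n k : ℕ) → List (Vec (Fin n) k)
  injections n k = filter isInjection? (allVecs n k)

  falling : ℕ → ℕ → ℕ
  falling n       zero    = 1
  falling zero    (suc k) = 0
  falling (suc n) (suc k) = suc n * falling n k

  falling-*-! : ∀ n k → k ≤ n → falling n k * (n ∸ k) ! ≡ n !
  falling-*-! n       zero    _         = *-identityˡ (n !)
  falling-*-! (suc n) (suc k) (s≤s k≤n) =
    trans (*-assoc (suc n) (falling n k) _) (cong (suc n *_) (falling-*-! n k k≤n))

  ∈-allVecs : ∀ {n k} (v : Vec (Fin n) k) → v ∈ allVecs n k
  ∈-allVecs []      = here refl
  ∈-allVecs (a ∷ v) = ∈-cartesianProductWith⁺ _∷_ (∈-allFin a) (∈-allVecs v)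

  allVecs-unique : ∀ n k → Unique (allVecs n k)
  allVecs-unique n zero    = All.[] ∷ []
  allVecs-unique n (suc k) = Unique.cartesianProductWith⁺ _∷_ ∷-injective (Unique.allFin⁺ n) (allVecs-unique n k)

  module _ {n : ℕ} (x : Fin (suc n)) where

    private
      punchIns : ∀ {k} → Vec (Fin n) k → Vec (Fin (suc n)) k
      punchIns = Vec.map (punchIn x)

    ∷-injection⇒avoids : ∀ {k} {v : Vec (Fin (suc n)) k} → IsInjection (x ∷ v) → ∀ i → x ≢ lookup v i
    ∷-injection⇒avoids inj i x≡vi with inj zero (suc i) x≡vi
    ... | ()

    avoids⇒punchIns : ∀ {k} (v : Vec (Fin (suc n)) k) → (∀ i → x ≢ lookup v i) → ∃ λ w → punchIns w ≡ v
    avoids⇒punchIns []      _   = [] , refl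
    avoids⇒punchIns (a ∷ v) x∉v with avoids⇒punchIns v (x∉v ∘ suc)
    ... | w , refl = punchOut (x∉v zero) ∷ w , cong (_∷ punchIns w) (punchIn-punchOut (x∉v zero))

    punchIns-injective : ∀ {k} (v w : Vec (Fin n) k) → punchIns v ≡ punchIns w → v ≡ w
    punchIns-injective []      []      _  = refl
    punchIns-injective (a ∷ v) (b ∷ w) eq =
      cong₂ _∷_ (punchIn-injective x a b (proj₁ (∷-injective eq))) (punchIns-injective v w (proj₂ (∷-injective eq)))

    punchIns-injection⁺ : ∀ {k} {w : Vec (Fin n) k} → IsInjection w → IsInjection (x ∷ punchIns w)
    punchIns-injection⁺         inj zero    zero    _  = refl
    punchIns-injection⁺ {w = w} inj zero    (suc j) eq =
      ⊥-elim (punchInᵢ≢i x (lookup w j) (sym (trans eq (lookup-map j (punchIn x) w))))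
    punchIns-injection⁺ {w = w} inj (suc i) zero    eq =
      ⊥-elim (punchInᵢ≢i x (lookup w i) (trans (sym (lookup-map i (punchIn x) w)) eq))
    punchIns-injection⁺ {w = w} inj (suc i) (suc j) eq = cong suc (inj i j (punchIn-injective x _ _
      (trans (sym (lookup-map i (punchIn x) w)) (trans eq (lookup-map j (punchIn x) w)))))

    punchIns-injection⁻ : ∀ {k} {w : Vec (Fin n) k} → IsInjection (x ∷ punchIns w) → IsInjection w
    punchIns-injection⁻ {w = w} inj i j eq = suc-injectiveᶠ (inj (suc i) (suc j)
      (trans (lookup-map i (punchIn x) w) (trans (cong (punchIn x) eq) (sym (lookup-map j (punchIn x) w)))))

    length-injections-starting-with : ∀ k →
      length (filter (isInjection? ∘ (x ∷_)) (allVecs (suc n) k)) ≡ length (injections n k)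
    length-injections-starting-with k = ≤-antisym
      (≤-trans (length-≤-⊆ (Unique.filter⁺ (isInjection? ∘ (x ∷_)) (allVecs-unique (suc n) k)) ⊆punchIns)
               (≤-reflexive (length-map punchIns (injections n k))))
      (length-≤-injectiveOn punchIns (Unique.filter⁺ isInjection? (allVecs-unique n k))
        (λ _ _ → punchIns-injective _ _)
        (λ {w} w∈ → ∈-filter⁺ (isInjection? ∘ (x ∷_)) (∈-allVecs (punchIns w))
                      (punchIns-injection⁺ (proj₂ (∈-filter⁻ isInjection? {xs = allVecs n k} w∈)))))
      where
      starting-with : ∀ {v} → v ∈ filter (isInjection? ∘ (x ∷_)) (allVecs (suc n) k) → IsInjection (x ∷ v)
      starting-with v∈ = proj₂ (∈-filter⁻ (isInjection? ∘ (x ∷_)) {xs = allVecs (suc n) k} v∈)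
      ⊆punchIns : ∀ {v} → v ∈ filter (isInjection? ∘ (x ∷_)) (allVecs (suc n) k) → v ∈ map punchIns (injections n k)
      ⊆punchIns {v} v∈ with avoids⇒punchIns v (∷-injection⇒avoids (starting-with v∈))
      ... | w , refl = ∈-map⁺ punchIns (∈-filter⁺ isInjection? (∈-allVecs w) (punchIns-injection⁻ (starting-with v∈)))

  length-injections : ∀ n k → length (injections n k) ≡ falling n k
  length-injections n       zero    = refl
  length-injections zero    (suc k) = refl
  length-injections (suc n) (suc k) = begin
    length (injections (suc n) (suc k))
      ≡⟨ length-filter-cartesianProductWith isInjection? _∷_ (allFin (suc n)) (allVecs (suc n) k) ⟩
    sum (map (λ x → length (filter (isInjection? ∘ (x ∷_)) (allVecs (suc n) k))) (allFin (suc n)))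
      ≡⟨ sum-map-cong _ (λ _ → falling n k) (allFin (suc n))
           (λ {x} _ → trans (length-injections-starting-with x k) (length-injections n k)) ⟩
    sum (map (λ _ → falling n k) (allFin (suc n)))
      ≡⟨ sum-map-const (falling n k) (allFin (suc n)) ⟩
    falling n k * length (allFin (suc n))
      ≡⟨ cong (falling n k *_) (length-tabulate {n = suc n} id) ⟩
    falling n k * suc n
      ≡⟨ *-comm (falling n k) (suc n) ⟩
    suc n * falling n k ∎
    where open ≡-Reasoning

  -- Opaque, since otherwise the type checker starts evaluating the enumeration Sym n
  -- (for n = suc m) whenever it compares two list expressions built from it.
  opaque
    perms : (n : ℕ) → List (Vecs n)
    perms = Sym

    perms-unique : ∀ n → Unique (perms n)
    perms-unique n = Unique.filter⁺ isPerm? (allVecs-unique n n)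

    ∈-perms : ∀ {n} {π : Vecs n} → IsPerm π → π ∈ perms n
    ∈-perms {π = π} = ∈-filter⁺ isPerm? (∈-allVecs π)

    ∈-perms⇒isPerm : ∀ {n} {π : Vecs n} → π ∈ perms n → IsPerm π
    ∈-perms⇒isPerm {n} π∈ = proj₂ (∈-filter⁻ isPerm? {xs = allVecs n n} π∈)

    length-perms : ∀ n → length (perms n) ≡ n !
    length-perms n = begin
      length (perms n)         ≡⟨⟩
      length (injections n n)  ≡⟨ length-injections n n ⟩
      falling n n              ≡⟨ *-identityʳ _ ⟨
      falling n n * 1          ≡⟨ cong (λ k → falling n n * k !) (n∸n≡0 n) ⟨
      falling n n * (n ∸ n) !  ≡⟨ falling-*-! n n ≤-refl ⟩
      n !                      ∎
      where open ≡-Reasoning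

  vec-ext : ∀ {k} {v w : Vec A k} → (∀ i → lookup v i ≡ lookup w i) → v ≡ w
  vec-ext {v = v} {w} v≗w = trans (sym (tabulate∘lookup v)) (trans (tabulate-cong v≗w) (tabulate∘lookup w))

  lookup-∘ₚ : ∀ {n} (π τ : Vecs n) i → lookup (π ∘ₚ τ) i ≡ lookup π (lookup τ i)
  lookup-∘ₚ π τ = lookup∘tabulate (λ j → lookup π (lookup τ j))

  -- Rotations of ℤ_N and the action of ℤ_N × ℤ_N on S_N

  module Rotations (m : ℕ) where

    open ≡-Reasoning

    private
      N = suc m

    %-absorbˡ : ∀ a b → (a % N + b) % N ≡ (a + b) % N
    %-absorbˡ a b = begin
      (a % N + b) % N           ≡⟨ %-distribˡ-+ (a % N) b N ⟩
      (a % N % N + b % N) % N   ≡⟨ cong (λ c → (c + b % N) % N) (m%n%n≡m%n a N) ⟩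
      (a % N + b % N) % N       ≡⟨ %-distribˡ-+ a b N ⟨
      (a + b) % N               ∎

    opaque
      rotate : ℕ → Fin N → Fin N
      rotate k i = (toℕ i + k) mod N

      toℕ-rotate : ∀ k i → toℕ (rotate k i) ≡ (toℕ i + k) % N
      toℕ-rotate k i = toℕ-fromℕ< _

      σfun≡rotate1 : ∀ i → σfun i ≡ rotate 1 i
      σfun≡rotate1 i = cong (_mod N) (+-comm 1 (toℕ i))

    rotate-cong : ∀ {a b} → a % N ≡ b % N → ∀ i → rotate a i ≡ rotate b i
    rotate-cong {a} {b} a≡b i = toℕ-injective (begin
      toℕ (rotate a i)               ≡⟨ toℕ-rotate a i ⟩
      (toℕ i + a) % N                ≡⟨ %-distribˡ-+ (toℕ i) a N ⟩
      (toℕ i % N + a % N) % N        ≡⟨ cong (λ c → (toℕ i % N + c) % N) a≡b ⟩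
      (toℕ i % N + b % N) % N        ≡⟨ %-distribˡ-+ (toℕ i) b N ⟨
      (toℕ i + b) % N                ≡⟨ toℕ-rotate b i ⟨
      toℕ (rotate b i)               ∎)

    rotate-zero : ∀ i → rotate 0 i ≡ i
    rotate-zero i = toℕ-injective (begin
      toℕ (rotate 0 i)  ≡⟨ toℕ-rotate 0 i ⟩
      (toℕ i + 0) % N   ≡⟨ cong (_% N) (+-identityʳ (toℕ i)) ⟩
      toℕ i % N         ≡⟨ m<n⇒m%n≡m (toℕ<n i) ⟩
      toℕ i             ∎)

    rotate-rotate : ∀ a b i → rotate a (rotate b i) ≡ rotate (b + a) i
    rotate-rotate a b i = toℕ-injective (begin
      toℕ (rotate a (rotate b i)) ≡⟨ toℕ-rotate a (rotate b i) ⟩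
      (toℕ (rotate b i) + a) % N  ≡⟨ cong (λ c → (c + a) % N) (toℕ-rotate b i) ⟩
      ((toℕ i + b) % N + a) % N   ≡⟨ %-absorbˡ (toℕ i + b) a ⟩
      (toℕ i + b + a) % N         ≡⟨ cong (_% N) (+-assoc (toℕ i) b a) ⟩
      (toℕ i + (b + a)) % N       ≡⟨ toℕ-rotate (b + a) i ⟨
      toℕ (rotate (b + a) i)      ∎)

    rotate-multiple : ∀ {a} → a % N ≡ 0 → ∀ i → rotate a i ≡ i
    rotate-multiple a≡0 i = trans (rotate-cong a≡0 i) (rotate-zero i)

    rotate-comm : ∀ (u v : Fin N) → rotate (toℕ u) v ≡ rotate (toℕ v) u
    rotate-comm u v = toℕ-injective (begin
      toℕ (rotate (toℕ u) v) ≡⟨ toℕ-rotate (toℕ u) v ⟩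
      (toℕ v + toℕ u) % N    ≡⟨ cong (_% N) (+-comm (toℕ v) (toℕ u)) ⟩
      (toℕ u + toℕ v) % N    ≡⟨ toℕ-rotate (toℕ v) u ⟨
      toℕ (rotate (toℕ v) u) ∎)

    -- An inverse of a modulo N; it is N rather than 0 when N divides a.
    -ᴺ_ : ℕ → ℕ
    -ᴺ a = N ∸ a % N

    +-inverseʳ : ∀ a → (a + -ᴺ a) % N ≡ 0
    +-inverseʳ a = begin
      (a + (N ∸ a % N)) % N      ≡⟨ %-absorbˡ a (N ∸ a % N) ⟨
      (a % N + (N ∸ a % N)) % N  ≡⟨ cong (_% N) (m+[n∸m]≡n (m%n≤n a N)) ⟩
      N % N                      ≡⟨ n%n≡0 N ⟩
      0                          ∎

    +-inverseˡ : ∀ a → (-ᴺ a + a) % N ≡ 0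
    +-inverseˡ a = trans (cong (_% N) (+-comm (-ᴺ a) a)) (+-inverseʳ a)

    rotate-inverseˡ : ∀ a i → rotate (-ᴺ a) (rotate a i) ≡ i
    rotate-inverseˡ a i = trans (rotate-rotate (-ᴺ a) a i) (rotate-multiple (+-inverseʳ a) i)

    rotate-inverseʳ : ∀ a i → rotate a (rotate (-ᴺ a) i) ≡ i
    rotate-inverseʳ a i = trans (rotate-rotate a (-ᴺ a) i) (rotate-multiple (+-inverseˡ a) i)

    rotate-injective : ∀ a {i j} → rotate a i ≡ rotate a j → i ≡ j
    rotate-injective a {i} {j} eq = trans (sym (rotate-inverseˡ a i)) (trans (cong (rotate (-ᴺ a)) eq) (rotate-inverseˡ a j))

    lookup-σ^ : ∀ k i → lookup (σ^ {N} k) i ≡ rotate k i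
    lookup-σ^ zero    i = trans (lookup∘tabulate id i) (sym (rotate-zero i))
    lookup-σ^ (suc k) i = begin
      lookup (σ ∘ₚ σ^ k) i         ≡⟨ lookup-∘ₚ σ (σ^ k) i ⟩
      lookup σ (lookup (σ^ k) i)   ≡⟨ lookup∘tabulate σfun (lookup (σ^ k) i) ⟩
      σfun (lookup (σ^ k) i)       ≡⟨ cong σfun (lookup-σ^ k i) ⟩
      σfun (rotate k i)            ≡⟨ σfun≡rotate1 (rotate k i) ⟩
      rotate 1 (rotate k i)        ≡⟨ rotate-rotate 1 k i ⟩
      rotate (k + 1) i             ≡⟨ cong (λ c → rotate c i) (+-comm k 1) ⟩
      rotate (suc k) i             ∎

    -- twist a b π = σ^a ∘ π ∘ σ^b.  Both rotate and twist are opaque, which keeps their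
    -- amounts inferable from the types.
    opaque
      twist : ℕ → ℕ → Vecs N → Vecs N
      twist a b π = tabulate λ i → rotate a (lookup π (rotate b i))

      lookup-twist : ∀ a b π i → lookup (twist a b π) i ≡ rotate a (lookup π (rotate b i))
      lookup-twist a b π = lookup∘tabulate (λ i → rotate a (lookup π (rotate b i)))

    twist-cong : ∀ {a a′ b b′} → a % N ≡ a′ % N → b % N ≡ b′ % N → ∀ π → twist a b π ≡ twist a′ b′ π
    twist-cong {a} {a′} {b} {b′} a≡a′ b≡b′ π = vec-ext λ i → begin
      lookup (twist a b π) i             ≡⟨ lookup-twist a b π i ⟩
      rotate a (lookup π (rotate b i))   ≡⟨ cong (rotate a ∘′ lookup π) (rotate-cong b≡b′ i) ⟩
      rotate a (lookup π (rotate b′ i))  ≡⟨ rotate-cong a≡a′ _ ⟩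
      rotate a′ (lookup π (rotate b′ i)) ≡⟨ lookup-twist a′ b′ π i ⟨
      lookup (twist a′ b′ π) i           ∎

    twist-zero : ∀ π → twist 0 0 π ≡ π
    twist-zero π = vec-ext λ i → begin
      lookup (twist 0 0 π) i          ≡⟨ lookup-twist 0 0 π i ⟩
      rotate 0 (lookup π (rotate 0 i)) ≡⟨ rotate-zero _ ⟩
      lookup π (rotate 0 i)            ≡⟨ cong (lookup π) (rotate-zero i) ⟩
      lookup π i                       ∎

    twist-multiple : ∀ {a b} → a % N ≡ 0 → b % N ≡ 0 → ∀ π → twist a b π ≡ π
    twist-multiple a≡0 b≡0 π = trans (twist-cong a≡0 b≡0 π) (twist-zero π)

    twist-twist : ∀ a b a′ b′ π → twist a b (twist a′ b′ π) ≡ twist (a′ + a) (b + b′) π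
    twist-twist a b a′ b′ π = vec-ext λ i → begin
      lookup (twist a b (twist a′ b′ π)) i                       ≡⟨ lookup-twist a b _ i ⟩
      rotate a (lookup (twist a′ b′ π) (rotate b i))             ≡⟨ cong (rotate a) (lookup-twist a′ b′ π _) ⟩
      rotate a (rotate a′ (lookup π (rotate b′ (rotate b i))))   ≡⟨ rotate-rotate a a′ _ ⟩
      rotate (a′ + a) (lookup π (rotate b′ (rotate b i)))        ≡⟨ cong (λ j → rotate (a′ + a) (lookup π j)) (rotate-rotate b′ b i) ⟩
      rotate (a′ + a) (lookup π (rotate (b + b′) i))             ≡⟨ lookup-twist (a′ + a) (b + b′) π i ⟨
      lookup (twist (a′ + a) (b + b′) π) i                       ∎

    twist-inverse : ∀ a b π → twist (-ᴺ a) (-ᴺ b) (twist a b π) ≡ π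
    twist-inverse a b π = trans (twist-twist (-ᴺ a) (-ᴺ b) a b π) (twist-multiple (+-inverseʳ a) (+-inverseˡ b) π)

    σ^-∘ₚ : ∀ k π → σ^ k ∘ₚ π ≡ twist k 0 π
    σ^-∘ₚ k π = vec-ext λ i → begin
      lookup (σ^ k ∘ₚ π) i          ≡⟨ lookup-∘ₚ (σ^ k) π i ⟩
      lookup (σ^ k) (lookup π i)    ≡⟨ lookup-σ^ k (lookup π i) ⟩
      rotate k (lookup π i)         ≡⟨ cong (rotate k ∘′ lookup π) (rotate-zero i) ⟨
      rotate k (lookup π (rotate 0 i)) ≡⟨ lookup-twist k 0 π i ⟨
      lookup (twist k 0 π) i        ∎

    ∘ₚ-σ^ : ∀ k π → π ∘ₚ σ^ k ≡ twist 0 k π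
    ∘ₚ-σ^ k π = vec-ext λ i → begin
      lookup (π ∘ₚ σ^ k) i          ≡⟨ lookup-∘ₚ π (σ^ k) i ⟩
      lookup π (lookup (σ^ k) i)    ≡⟨ cong (lookup π) (lookup-σ^ k i) ⟩
      lookup π (rotate k i)         ≡⟨ rotate-zero _ ⟨
      rotate 0 (lookup π (rotate k i)) ≡⟨ lookup-twist 0 k π i ⟨
      lookup (twist 0 k π) i        ∎

    toℕ-mod-% : ∀ k → toℕ (k mod N) % N ≡ k % N
    toℕ-mod-% k = trans (cong (_% N) (toℕ-fromℕ< (m%n<n k N))) (m%n%n≡m%n k N)

    sameClass⇒twist : ∀ {π π′} → SameClass π π′ → ∃ λ k → π′ ≡ twist k 0 π
    sameClass⇒twist {π} (k , π′≡) = toℕ k , trans π′≡ (σ^-∘ₚ (toℕ k) π)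

    twist⇒sameClass : ∀ {π π′ k} → π′ ≡ twist k 0 π → SameClass π π′
    twist⇒sameClass {π} {π′} {k} π′≡ = k mod N , (begin
      π′                       ≡⟨ π′≡ ⟩
      twist k 0 π              ≡⟨ twist-cong (sym (toℕ-mod-% k)) refl π ⟩
      twist (toℕ (k mod N)) 0 π ≡⟨ σ^-∘ₚ _ π ⟨
      σ^ (toℕ (k mod N)) ∘ₚ π  ∎)

    sameOrbit⇒twist : ∀ {π π′} → SameOrbit π π′ → ∃₂ λ a b → π′ ≡ twist a b π
    sameOrbit⇒twist {π} {π′} (j , sc) with sameClass⇒twist {π′} {π ∘ₚ σ^ (toℕ j)} sc
    ... | k , π∘σ^j≡ = -ᴺ k , toℕ j , (begin
      π′                              ≡⟨ twist-multiple (+-inverseʳ k) refl π′ ⟨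
      twist (k + -ᴺ k) 0 π′           ≡⟨ twist-twist (-ᴺ k) 0 k 0 π′ ⟨
      twist (-ᴺ k) 0 (twist k 0 π′)   ≡⟨ cong (twist (-ᴺ k) 0) π∘σ^j≡ ⟨
      twist (-ᴺ k) 0 (π ∘ₚ σ^ (toℕ j)) ≡⟨ cong (twist (-ᴺ k) 0) (∘ₚ-σ^ (toℕ j) π) ⟩
      twist (-ᴺ k) 0 (twist 0 (toℕ j) π) ≡⟨ twist-twist (-ᴺ k) 0 0 (toℕ j) π ⟩
      twist (-ᴺ k) (toℕ j) π          ∎)

    twist⇒sameOrbit : ∀ {π π′ a b} → π′ ≡ twist a b π → SameOrbit π π′
    twist⇒sameOrbit {π} {π′} {a} {b} π′≡ = b mod N , twist⇒sameClass {π′} {π ∘ₚ σ^ (toℕ (b mod N))} { -ᴺ a} (begin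
      π ∘ₚ σ^ (toℕ (b mod N))         ≡⟨ ∘ₚ-σ^ _ π ⟩
      twist 0 (toℕ (b mod N)) π       ≡⟨ twist-cong (sym (+-inverseʳ a)) (toℕ-mod-% b) π ⟩
      twist (a + -ᴺ a) b π            ≡⟨ twist-twist (-ᴺ a) 0 a b π ⟨
      twist (-ᴺ a) 0 (twist a b π)    ≡⟨ cong (twist (-ᴺ a) 0) π′≡ ⟨
      twist (-ᴺ a) 0 π′               ∎)

    sameClass-refl : ∀ π → SameClass π π
    sameClass-refl π = twist⇒sameClass {π} {π} {0} (sym (twist-zero π))

    sameClass-trans : ∀ {π π′ π″} → SameClass π π′ → SameClass π′ π″ → SameClass π π″
    sameClass-trans {π} {π′} {π″} sc sc′ =
      let k  , π′≡ = sameClass⇒twist {π} {π′} sc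
          k′ , π″≡ = sameClass⇒twist {π′} {π″} sc′
      in  twist⇒sameClass {π} {π″} {k + k′} (trans π″≡ (trans (cong (twist k′ 0) π′≡) (twist-twist k′ 0 k 0 π)))

    sameClass⇒sameOrbit : ∀ {π π′} → SameClass π π′ → SameOrbit π π′
    sameClass⇒sameOrbit {π} {π′} sc =
      let k , π′≡ = sameClass⇒twist {π} {π′} sc
      in  twist⇒sameOrbit {π} {π′} {k} {0} π′≡

    sameOrbit-refl : ∀ π → SameOrbit π π
    sameOrbit-refl π = twist⇒sameOrbit {π} {π} {0} {0} (sym (twist-zero π))

    sameOrbit-sym : ∀ {π π′} → SameOrbit π π′ → SameOrbit π′ π
    sameOrbit-sym {π} {π′} so =
      let a , b , π′≡ = sameOrbit⇒twist {π} {π′} so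
      in  twist⇒sameOrbit {π′} {π} { -ᴺ a} { -ᴺ b}
            (trans (sym (twist-inverse a b π)) (cong (twist (-ᴺ a) (-ᴺ b)) (sym π′≡)))

    sameOrbit-trans : ∀ {π π′ π″} → SameOrbit π π′ → SameOrbit π′ π″ → SameOrbit π π″
    sameOrbit-trans {π} {π′} {π″} so so′ =
      let a  , b  , π′≡ = sameOrbit⇒twist {π} {π′} so
          a′ , b′ , π″≡ = sameOrbit⇒twist {π′} {π″} so′
      in  twist⇒sameOrbit {π} {π″} {a + a′} {b′ + b}
            (trans π″≡ (trans (cong (twist a′ b′) π′≡) (twist-twist a′ b′ a b π)))

  module Orbits (m : ℕ) where

    open Rotations m

    private
      N = suc m

    twist-isPerm : ∀ a b {π} → IsPerm π → IsPerm (twist a b π)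
    twist-isPerm a b {π} π-perm i j eq = rotate-injective b (π-perm _ _ (rotate-injective a (begin
      rotate a (lookup π (rotate b i)) ≡⟨ lookup-twist a b π i ⟨
      lookup (twist a b π) i           ≡⟨ eq ⟩
      lookup (twist a b π) j           ≡⟨ lookup-twist a b π j ⟩
      rotate a (lookup π (rotate b j)) ∎)))
      where open ≡-Reasoning

    twistᶠ : Fin N × Fin N → Vecs N → Vecs N
    twistᶠ (a , b) = twist (toℕ a) (toℕ b)

    shifts : List (Fin N × Fin N)
    shifts = cartesianProduct (allFin N) (allFin N)

    length-shifts : length shifts ≡ N * N
    length-shifts = trans (length-cartesianProductWith _,_ (allFin N) (allFin N))
      (cong₂ _*_ (length-tabulate {n = N} id) (length-tabulate {n = N} id))

    twist≡twistᶠ-mod : ∀ a b π → twist a b π ≡ twistᶠ (a mod N , b mod N) π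
    twist≡twistᶠ-mod a b π = twist-cong {a} {toℕ (a mod N)} {b} {toℕ (b mod N)} (sym (toℕ-mod-% a)) (sym (toℕ-mod-% b)) π

    ∈-shifts : ∀ p → p ∈ shifts
    ∈-shifts (a , b) = ∈-cartesianProduct⁺ (∈-allFin a) (∈-allFin b)

    twists : Vecs N → List (Vecs N)
    twists π = map (λ p → twistᶠ p π) shifts

    orbit : Vecs N → List (Vecs N)
    orbit π = filter (sameOrbit? π) (perms N)

    twist∈twists : ∀ {π π′} → (∃₂ λ a b → π′ ≡ twist a b π) → π′ ∈ twists π
    twist∈twists {π} (a , b , π′≡) = subst (_∈ twists π) (sym (trans π′≡ (twist≡twistᶠ-mod a b π)))
      (∈-map⁺ (λ p → twistᶠ p π) (∈-shifts (a mod N , b mod N)))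

    orbit⊆twists : ∀ π → orbit π ⊆ twists π
    orbit⊆twists π {π′} π′∈ =
      twist∈twists (sameOrbit⇒twist {π} {π′} (proj₂ (∈-filter⁻ (sameOrbit? π) {xs = perms N} π′∈)))

    length-orbit-≤ : ∀ π → length (orbit π) ≤ N * N
    length-orbit-≤ π = begin
      length (orbit π)  ≤⟨ length-≤-⊆ (Unique.filter⁺ (sameOrbit? π) (perms-unique N)) (orbit⊆twists π) ⟩
      length (twists π) ≡⟨ length-map _ shifts ⟩
      length shifts     ≡⟨ length-shifts ⟩
      N * N             ∎
      where open ≤-Reasoning

    NonFree : Vecs N → Set
    NonFree π = ∃ λ a → ∃ λ b → ∃ λ a′ → ∃ λ b′ →
      (a , b) ≢ (a′ , b′) × twistᶠ (a , b) π ≡ twistᶠ (a′ , b′) π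

    nonFree? : Decidable NonFree
    nonFree? π = any? λ a → any? λ b → any? λ a′ → any? λ b′ →
      ¬? (Product.≡-dec _≟ᶠ_ _≟ᶠ_ (a , b) (a′ , b′)) ×-dec ≡-dec _≟ᶠ_ (twistᶠ (a , b) π) (twistᶠ (a′ , b′) π)

    Free : Vecs N → Set
    Free π = ¬ NonFree π

    free? : Decidable Free
    free? = ∁? nonFree?

    free⇒twistᶠ-injective : ∀ {π} → Free π → ∀ {p q} → twistᶠ p π ≡ twistᶠ q π → p ≡ q
    free⇒twistᶠ-injective π-free {a , b} {a′ , b′} eq with Product.≡-dec _≟ᶠ_ _≟ᶠ_ (a , b) (a′ , b′)
    ... | yes p≡q = p≡q
    ... | no p≢q  = ⊥-elim (π-free (a , b , a′ , b′ , p≢q , eq))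

    twists⊆orbit : ∀ {π} → IsPerm π → twists π ⊆ orbit π
    twists⊆orbit {π} π-perm {π′} π′∈ = twistᶠ∈orbit (∈-map⁻ (λ p → twistᶠ p π) π′∈)
      where
      twistᶠ∈orbit : (∃ λ p → p ∈ shifts × π′ ≡ twistᶠ p π) → π′ ∈ orbit π
      twistᶠ∈orbit ((a , b) , _ , π′≡) = ∈-filter⁺ (sameOrbit? π)
        (∈-perms (subst IsPerm (sym π′≡) (twist-isPerm (toℕ a) (toℕ b) π-perm)))
        (twist⇒sameOrbit {π} {π′} {toℕ a} {toℕ b} π′≡)

    length-orbit-free : ∀ {π} → IsPerm π → Free π → N * N ≤ length (orbit π)
    length-orbit-free {π} π-perm π-free = begin
      N * N             ≡⟨ length-shifts ⟨
      length shifts     ≡⟨ length-map _ shifts ⟨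
      length (twists π) ≤⟨ length-≤-⊆ twists-unique (twists⊆orbit π-perm) ⟩
      length (orbit π)  ∎
      where
      open ≤-Reasoning
      twists-unique : Unique (twists π)
      twists-unique = Unique.map⁺ (free⇒twistᶠ-injective π-free)
        (Unique.cartesianProduct⁺ (Unique.allFin⁺ N) (Unique.allFin⁺ N))

    orbitSize-free : ∀ {π} → Free π → orbitSize π ≡ N
    orbitSize-free {π} π-free = begin
      orbitSize π                    ≡⟨ cong length (deduplicate-id sameClass?
                                          (AllPairs.map⁺ (AllPairs.map distinct (Unique.allFin⁺ N)))) ⟩
      length (map πσ^ (allFin N))    ≡⟨ length-map πσ^ (allFin N) ⟩
      length (allFin N)              ≡⟨ length-tabulate {n = N} id ⟩
      N                              ∎
      where
      open ≡-Reasoning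
      πσ^ : Fin N → Vecs N
      πσ^ j = π ∘ₚ σ^ (toℕ j)
      distinct : ∀ {j j′} → j ≢ j′ → ¬ SameClass (πσ^ j) (πσ^ j′)
      distinct {j} {j′} j≢j′ sc with sameClass⇒twist {πσ^ j} {πσ^ j′} sc
      ... | k , πσ^j′≡ = j≢j′ (sym (proj₂ (Product.,-injective (free⇒twistᶠ-injective π-free (begin
        twist 0 (toℕ j′) π                  ≡⟨ ∘ₚ-σ^ (toℕ j′) π ⟨
        πσ^ j′                              ≡⟨ πσ^j′≡ ⟩
        twist k 0 (πσ^ j)                   ≡⟨ cong (twist k 0) (∘ₚ-σ^ (toℕ j) π) ⟩
        twist k 0 (twist 0 (toℕ j) π)       ≡⟨ twist-twist k 0 0 (toℕ j) π ⟩
        twist k (toℕ j) π                   ≡⟨ twist-cong (sym (toℕ-mod-% k)) refl π ⟩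
        twist (toℕ (k mod N)) (toℕ j) π     ∎)))))

    -- Opaque for the same reason as perms.
    opaque
      unfolding perms

      reps : List (Vecs N)
      reps = orbitReps N

      reps≡orbitReps : reps ≡ orbitReps N
      reps≡orbitReps = refl

      reps⊆perms : reps ⊆ perms N
      reps⊆perms = deduplicate⁻ sameClass? ∘ deduplicate⁻ sameOrbit?

      reps-unique : Unique reps
      reps-unique = deduplicate-unique sameOrbit? sameOrbit-refl (classReps N)

      reps-pairwise : AllPairs (λ r r′ → ¬ SameOrbit r r′) reps
      reps-pairwise = deduplicate-pairwise sameOrbit? (classReps N)

      reps-cover : ∀ {π} → π ∈ perms N → ∃ λ r → r ∈ reps × SameOrbit r π
      reps-cover {π} π∈ =
        let c , c∈ , c~π = deduplicate-covers sameClass? (λ {x} {y} {z} → sameClass-trans {x} {y} {z}) sameClass-refl π∈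
            r , r∈ , r~c = deduplicate-covers sameOrbit? (λ {x} {y} {z} → sameOrbit-trans {x} {y} {z}) sameOrbit-refl c∈
        in  r , r∈ , sameOrbit-trans {r} {c} {π} r~c (sameClass⇒sameOrbit {c} {π} c~π)

    sum-length-orbit : sum (map (length ∘ orbit) reps) ≡ N !
    sum-length-orbit = begin
      sum (map (length ∘ orbit) reps)
        ≡⟨ sum-length-filter-comm sameOrbit? reps (perms N) ⟩
      sum (map (λ π → length (filter (λ r → sameOrbit? r π) reps)) (perms N))
        ≡⟨ sum-map-cong _ (λ _ → 1) (perms N) one-rep ⟩
      sum (map (λ _ → 1) (perms N))
        ≡⟨ sum-map-const 1 (perms N) ⟩
      1 * length (perms N)
        ≡⟨ *-identityˡ _ ⟩
      length (perms N)
        ≡⟨ length-perms N ⟩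
      N ! ∎
      where
      open ≡-Reasoning
      one-rep : ∀ {π} → π ∈ perms N → length (filter (λ r → sameOrbit? r π) reps) ≡ 1
      one-rep {π} π∈ =
        let r , r∈ , r~π = reps-cover π∈
        in  length-filter≡1 (λ r → sameOrbit? r π) (lose r∈ r~π) (AllPairs.map
              (λ {r} {r′} r≁r′ (r~π , r′~π) → r≁r′ (sameOrbit-trans {r} {π} {r′} r~π (sameOrbit-sym {r′} {π} r′~π)))
              reps-pairwise)

    freeReps nonFreeReps : ℕ
    freeReps    = length (filter free? reps)
    nonFreeReps = length (filter nonFree? reps)

    N*N*freeReps≤N! : N * N * freeReps ≤ N !
    N*N*freeReps≤N! = ≤-trans
      (*-length-filter-≤-sum free? (length ∘ orbit) (N * N) reps
        (λ r∈ r-free → length-orbit-free (∈-perms⇒isPerm (reps⊆perms r∈)) r-free))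
      (≤-reflexive sum-length-orbit)

    N!≤N*N*length-reps : N ! ≤ N * N * length reps
    N!≤N*N*length-reps = begin
      N !                              ≡⟨ sum-length-orbit ⟨
      sum (map (length ∘ orbit) reps)  ≤⟨ sum-map-mono _ (λ _ → N * N) reps (λ {r} _ → length-orbit-≤ r) ⟩
      sum (map (λ _ → N * N) reps)     ≡⟨ sum-map-const (N * N) reps ⟩
      N * N * length reps              ∎
      where open ≤-Reasoning

    length-reps : length reps ≡ nonFreeReps + freeReps
    length-reps = sym (length-filter+length-filter-∁ nonFree? reps)

    nonFreeReps≤ : nonFreeReps ≤ length (filter nonFree? (perms N))
    nonFreeReps≤ = length-≤-⊆ (Unique.filter⁺ nonFree? reps-unique) λ r∈ →
      let (r∈reps , r-nonFree) = ∈-filter⁻ nonFree? {xs = reps} r∈ in ∈-filter⁺ nonFree? (reps⊆perms r∈reps) r-nonFree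

    freeReps≤L : freeReps ≤ L N
    freeReps≤L = begin
      freeReps
        ≤⟨ length-filter-mono free? (λ π → orbitSize π ≟ N) orbitSize-free reps ⟩
      length (filter (λ π → orbitSize π ≟ N) reps)
        ≡⟨ cong (length ∘ filter (λ π → orbitSize π ≟ N)) reps≡orbitReps ⟩
      cycles1 N N
        ≤⟨ ≤-sum-map (cycles1 N) (filter (_∣? N) (applyUpTo suc N)) N∈divisors ⟩
      L N ∎
      where
      open ≤-Reasoning
      N∈divisors : N ∈ filter (_∣? N) (applyUpTo suc N)
      N∈divisors = ∈-filter⁺ (_∣? N) (∈-applyUpTo⁺ suc (n<1+n m)) ∣-refl

    L≤length-reps : L N ≤ length reps
    L≤length-reps = begin
      L N                  ≤⟨ sum-length-fibres-≤ orbitSize divisors-unique (orbitReps N) ⟩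
      length (orbitReps N) ≡⟨ cong length reps≡orbitReps ⟨
      length reps          ∎
      where
      open ≤-Reasoning
      divisors-unique : Unique (filter (_∣? N) (applyUpTo suc N))
      divisors-unique = Unique.filter⁺ (_∣? N) (Unique.applyUpTo⁺₁ suc N (λ i<j _ → <⇒≢ i<j ∘ suc-injective))

  -- Counting the non-free permutations

  module NonFreeCount (m : ℕ) where

    open Rotations m
    open Orbits m

    private
      N = suc m
      h = ⌊ N /2⌋

    Intertwines : ℕ → ℕ → Vecs N → Set
    Intertwines d e π = ∀ j → lookup π (rotate d j) ≡ rotate e (lookup π j)

    intertwines? : ∀ d e → Decidable (Intertwines d e)
    intertwines? d e π = all? λ j → lookup π (rotate d j) ≟ᶠ rotate e (lookup π j)

    intertwines-cong : ∀ {d d′ e e′ π} → d % N ≡ d′ % N → e % N ≡ e′ % N → Intertwines d e π → Intertwines d′ e′ π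
    intertwines-cong {π = π} d≡d′ e≡e′ π-int j =
      trans (cong (lookup π) (sym (rotate-cong d≡d′ j))) (trans (π-int j) (rotate-cong e≡e′ _))

    intertwines-inverse : ∀ {d e π} → Intertwines d e π → Intertwines (-ᴺ d) (-ᴺ e) π
    intertwines-inverse {d} {e} {π} π-int j = begin
      lookup π (rotate (-ᴺ d) j)                           ≡⟨ rotate-inverseˡ e _ ⟨
      rotate (-ᴺ e) (rotate e (lookup π (rotate (-ᴺ d) j))) ≡⟨ cong (rotate (-ᴺ e)) (π-int _) ⟨
      rotate (-ᴺ e) (lookup π (rotate d (rotate (-ᴺ d) j))) ≡⟨ cong (rotate (-ᴺ e) ∘′ lookup π) (rotate-inverseʳ d j) ⟩
      rotate (-ᴺ e) (lookup π j)                           ∎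
      where open ≡-Reasoning

    twists-coincide⇒intertwines : ∀ {a b a′ b′ π} →
      (∀ i → rotate a (lookup π (rotate b i)) ≡ rotate a′ (lookup π (rotate b′ i))) →
      Intertwines (-ᴺ b′ + b) (a′ + -ᴺ a) π
    twists-coincide⇒intertwines {a} {b} {a′} {b′} {π} coincide j = begin
      lookup π (rotate (-ᴺ b′ + b) j)
        ≡⟨ rotate-inverseˡ a _ ⟨
      rotate (-ᴺ a) (rotate a (lookup π (rotate (-ᴺ b′ + b) j)))
        ≡⟨ cong (rotate (-ᴺ a) ∘′ rotate a ∘′ lookup π) (rotate-rotate b (-ᴺ b′) j) ⟨
      rotate (-ᴺ a) (rotate a (lookup π (rotate b (rotate (-ᴺ b′) j))))
        ≡⟨ cong (rotate (-ᴺ a)) (coincide _) ⟩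
      rotate (-ᴺ a) (rotate a′ (lookup π (rotate b′ (rotate (-ᴺ b′) j))))
        ≡⟨ cong (rotate (-ᴺ a) ∘′ rotate a′ ∘′ lookup π) (rotate-inverseʳ b′ j) ⟩
      rotate (-ᴺ a) (rotate a′ (lookup π j))
        ≡⟨ rotate-rotate (-ᴺ a) a′ _ ⟩
      rotate (a′ + -ᴺ a) (lookup π j) ∎
      where open ≡-Reasoning

    rotate-cancelʳ : ∀ {a a′} (y : Fin N) → rotate (toℕ a) y ≡ rotate (toℕ a′) y → a ≡ a′
    rotate-cancelʳ {a} {a′} y eq = rotate-injective (toℕ y) (trans (sym (rotate-comm a y)) (trans eq (rotate-comm a′ y)))

    private
      module NonFreeWitness {π a b a′ b′} (ab≢a′b′ : (a , b) ≢ (a′ , b′))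
                            (twists≡ : twistᶠ (a , b) π ≡ twistᶠ (a′ , b′) π) where
        α = toℕ a
        β = toℕ b
        α′ = toℕ a′
        β′ = toℕ b′

        coincide : ∀ i → rotate α (lookup π (rotate β i)) ≡ rotate α′ (lookup π (rotate β′ i))
        coincide i = trans (sym (lookup-twist α β π i)) (trans (cong (λ v → lookup v i) twists≡) (lookup-twist α′ β′ π i))

        D = -ᴺ β′ + β
        d = D % N
        e = α′ + -ᴺ α

        π-int : Intertwines d e π
        π-int = intertwines-cong {D} {d} {π = π} (sym (m%n%n≡m%n D N)) refl
                  (twists-coincide⇒intertwines {α} {β} {α′} {β′} {π} coincide)

        a≡a′ : b ≡ b′ → a ≡ a′
        a≡a′ refl = rotate-cancelʳ {a} {a′} (lookup π (rotate β zero)) (coincide zero)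

        d≢0 : d ≢ 0
        d≢0 d≡0 = ab≢a′b′ (cong₂ _,_ (a≡a′ b≡b′) b≡b′)
          where
          z = rotate (-ᴺ β′) zero
          b≡b′ : b ≡ b′
          b≡b′ = rotate-cancelʳ z (trans (rotate-rotate β (-ᴺ β′) zero)
                   (trans (rotate-multiple d≡0 zero) (sym (rotate-inverseʳ β′ zero))))

    -- Two distinct twists agreeing on π give a nonzero shift d mod N that π intertwines;
    -- replacing it by N - d (and e by -ᴺ e) if needed makes d ≤ ⌊N/2⌋.
    nonFree⇒intertwines : ∀ {π} → NonFree π → ∃₂ λ d e → 1 ≤ d × d ≤ h × Intertwines d e π
    nonFree⇒intertwines {π} (a , b , a′ , b′ , ab≢a′b′ , twists≡) with NonFreeWitness.d ab≢a′b′ twists≡ ≤? h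
    ... | yes d≤h = d , e , n≢0⇒n>0 d≢0 , d≤h , π-int
      where open NonFreeWitness ab≢a′b′ twists≡
    ... | no d≰h  = N ∸ d , -ᴺ e , m<n⇒0<n∸m (m%n<n D N) , N∸d≤h ,
                    intertwines-cong { -ᴺ d} {N ∸ d} {π = π} (cong (λ x → (N ∸ x) % N) (m%n%n≡m%n D N)) refl
                      (intertwines-inverse {d} {π = π} π-int)
      where
      open NonFreeWitness ab≢a′b′ twists≡
      N∸d≤h : N ∸ d ≤ h
      N∸d≤h = begin
        N ∸ d              ≤⟨ ∸-monoʳ-≤ N (≤-trans (⌈n/2⌉≤1+⌊n/2⌋ N) (≰⇒> d≰h)) ⟩
        N ∸ ⌈ N /2⌉        ≡⟨ cong (_∸ ⌈ N /2⌉) (⌊n/2⌋+⌈n/2⌉≡n N) ⟨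
        h + ⌈ N /2⌉ ∸ ⌈ N /2⌉ ≡⟨ m+n∸n≡m h ⌈ N /2⌉ ⟩
        h                  ∎
        where open ≤-Reasoning

    prefix : Vecs N → Vec (Fin N) h
    prefix π = tabulate λ k → lookup π (inject≤ k (⌊n/2⌋≤n N))

    lookup-prefix : ∀ π k → lookup (prefix π) k ≡ lookup π (inject≤ k (⌊n/2⌋≤n N))
    lookup-prefix π = lookup∘tabulate (λ k → lookup π (inject≤ k (⌊n/2⌋≤n N)))

    prefix-injection : ∀ {π} → IsPerm π → IsInjection (prefix π)
    prefix-injection {π} π-perm k k′ eq = toℕ-injective (begin
      toℕ k                          ≡⟨ toℕ-inject≤ k (⌊n/2⌋≤n N) ⟨
      toℕ (inject≤ k (⌊n/2⌋≤n N))    ≡⟨ cong toℕ (π-perm _ _ (trans (sym (lookup-prefix π k)) (trans eq (lookup-prefix π k′)))) ⟩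
      toℕ (inject≤ k′ (⌊n/2⌋≤n N))   ≡⟨ toℕ-inject≤ k′ (⌊n/2⌋≤n N) ⟩
      toℕ k′                         ∎)
      where open ≡-Reasoning

    -- x j = x (j - d) + e for j ≥ d, so x is determined by its values below d ≤ ⌊N/2⌋.
    intertwines-determined : ∀ {d e x y} → 1 ≤ d → d ≤ h →
      Intertwines d e x → Intertwines d e y → prefix x ≡ prefix y → x ≡ y
    intertwines-determined {d} {e} {x} {y} 1≤d d≤h x-int y-int prefix≡ = vec-ext λ j → agree-below (suc (toℕ j)) j ≤-refl
      where
      open ≡-Reasoning
      agree-prefix : ∀ j → toℕ j < h → lookup x j ≡ lookup y j
      agree-prefix j j<h = begin
        lookup x j                          ≡⟨ cong (lookup x) inject≤k≡j ⟨
        lookup x (inject≤ k (⌊n/2⌋≤n N))    ≡⟨ lookup-prefix x k ⟨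
        lookup (prefix x) k                 ≡⟨ cong (λ v → lookup v k) prefix≡ ⟩
        lookup (prefix y) k                 ≡⟨ lookup-prefix y k ⟩
        lookup y (inject≤ k (⌊n/2⌋≤n N))    ≡⟨ cong (lookup y) inject≤k≡j ⟩
        lookup y j                          ∎
        where
        k = fromℕ< j<h
        inject≤k≡j : inject≤ k (⌊n/2⌋≤n N) ≡ j
        inject≤k≡j = toℕ-injective (trans (toℕ-inject≤ k (⌊n/2⌋≤n N)) (toℕ-fromℕ< j<h))
      agree-below : ∀ t j → toℕ j < t → lookup x j ≡ lookup y j
      agree-below (suc t) j (s≤s j≤t) with toℕ j <? d
      ... | yes j<d = agree-prefix j (≤-trans j<d d≤h)
      ... | no j≮d  = begin
        lookup x j              ≡⟨ cong (lookup x) rotate-d-j-d ⟨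
        lookup x (rotate d j-d) ≡⟨ x-int j-d ⟩
        rotate e (lookup x j-d) ≡⟨ cong (rotate e) (agree-below t j-d j-d<t) ⟩
        rotate e (lookup y j-d) ≡⟨ y-int j-d ⟨
        lookup y (rotate d j-d) ≡⟨ cong (lookup y) rotate-d-j-d ⟩
        lookup y j              ∎
        where
        d≤j : d ≤ toℕ j
        d≤j = ≮⇒≥ j≮d
        j-d<N : toℕ j ∸ d < N
        j-d<N = ≤-<-trans (m∸n≤m (toℕ j) d) (toℕ<n j)
        j-d = fromℕ< j-d<N
        j-d<t : toℕ j-d < t
        j-d<t = ≤-trans (≤-reflexive (cong suc (toℕ-fromℕ< j-d<N))) (≤-trans (∸-monoʳ-< {toℕ j} {d} {0} 1≤d d≤j) j≤t)
        rotate-d-j-d : rotate d j-d ≡ j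
        rotate-d-j-d = toℕ-injective (begin
          toℕ (rotate d j-d)  ≡⟨ toℕ-rotate d j-d ⟩
          (toℕ j-d + d) % N   ≡⟨ cong (λ i → (i + d) % N) (toℕ-fromℕ< j-d<N) ⟩
          (toℕ j ∸ d + d) % N ≡⟨ cong (_% N) (m∸n+n≡m d≤j) ⟩
          toℕ j % N           ≡⟨ m<n⇒m%n≡m (toℕ<n j) ⟩
          toℕ j               ∎)

    length-intertwining-≤ : ∀ d e → 1 ≤ d → d ≤ h → length (filter (intertwines? d e) (perms N)) ≤ falling N h
    length-intertwining-≤ d e 1≤d d≤h = begin
      length (filter (intertwines? d e) (perms N))
        ≤⟨ length-≤-injectiveOn prefix (Unique.filter⁺ (intertwines? d e) (perms-unique N))
             (λ x∈ y∈ → intertwines-determined 1≤d d≤h (proj₂ (member x∈)) (proj₂ (member y∈)))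
             (λ {x} x∈ → ∈-filter⁺ isInjection? (∈-allVecs (prefix x))
                           (prefix-injection {x} (∈-perms⇒isPerm (proj₁ (member x∈))))) ⟩
      length (injections N h) ≡⟨ length-injections N h ⟩
      falling N h             ∎
      where
      open ≤-Reasoning
      member : ∀ {x} → x ∈ filter (intertwines? d e) (perms N) → x ∈ perms N × Intertwines d e x
      member = ∈-filter⁻ (intertwines? d e) {xs = perms N}

    shiftPairs : List (ℕ × Fin N)
    shiftPairs = cartesianProduct (applyUpTo suc h) (allFin N)

    length-shiftPairs : length shiftPairs ≡ h * N
    length-shiftPairs = trans (length-cartesianProductWith _,_ (applyUpTo suc h) (allFin N))
      (cong₂ _*_ (length-applyUpTo suc h) (length-tabulate {n = N} id))

    intertwining : ℕ × Fin N → List (Vecs N)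
    intertwining (d , e) = filter (intertwines? d (toℕ e)) (perms N)

    nonFree⊆intertwining : filter nonFree? (perms N) ⊆ concat (map intertwining shiftPairs)
    nonFree⊆intertwining {x} x∈ = shortest-shift (nonFree⇒intertwines (proj₂ member))
      where
      member = ∈-filter⁻ nonFree? {xs = perms N} x∈
      shortest-shift : (∃₂ λ d e → 1 ≤ d × d ≤ h × Intertwines d e x) → x ∈ concat (map intertwining shiftPairs)
      shortest-shift (suc d , e , _ , d<h , x-int) = ∈-concat⁺′
        (∈-filter⁺ (intertwines? (suc d) (toℕ (e mod N))) (proj₁ member)
          (intertwines-cong {suc d} {suc d} {e} {toℕ (e mod N)} {x} refl (sym (toℕ-mod-% e)) x-int))
        (∈-map⁺ intertwining (∈-cartesianProduct⁺ (∈-applyUpTo⁺ suc d<h) (∈-allFin (e mod N))))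

    nonFreeBound : ℕ
    nonFreeBound = h * N * falling N h

    length-nonFree-≤ : length (filter nonFree? (perms N)) ≤ nonFreeBound
    length-nonFree-≤ = begin
      length (filter nonFree? (perms N))
        ≤⟨ length-≤-⊆ (Unique.filter⁺ nonFree? (perms-unique N)) nonFree⊆intertwining ⟩
      length (concat (map intertwining shiftPairs)) ≡⟨ length-concat-map intertwining shiftPairs ⟩
      sum (map (length ∘ intertwining) shiftPairs)  ≤⟨ sum-map-mono _ (λ _ → falling N h) shiftPairs bound ⟩
      sum (map (λ _ → falling N h) shiftPairs)      ≡⟨ sum-map-const (falling N h) shiftPairs ⟩
      falling N h * length shiftPairs               ≡⟨ cong (falling N h *_) length-shiftPairs ⟩
      falling N h * (h * N)                         ≡⟨ *-comm (falling N h) (h * N) ⟩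
      h * N * falling N h                           ∎
      where
      open ≤-Reasoning
      bound : ∀ {p} → p ∈ shiftPairs → length (intertwining p) ≤ falling N h
      bound {d , e} p∈ = bound′ (∈-applyUpTo⁻ suc (proj₁ (∈-cartesianProduct⁻ (applyUpTo suc h) (allFin N) p∈)))
        where
        bound′ : (∃ λ i → i < h × d ≡ suc i) → length (intertwining (d , e)) ≤ falling N h
        bound′ (i , i<h , refl) = length-intertwining-≤ (suc i) (toℕ e) (s≤s z≤n) i<h

    ∣N*N*L-N!∣≤N*N*nonFreeBound : ∣ N * N * L N - N ! ∣ ≤ N * N * nonFreeBound
    ∣N*N*L-N!∣≤N*N*nonFreeBound = ∣m-n∣≤o upper lower
      where
      open ≤-Reasoning
      K = nonFreeBound
      N*N*length-reps≤ : N * N * length reps ≤ N * N * K + N * N * freeReps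
      N*N*length-reps≤ = begin
        N * N * length reps                    ≡⟨ cong (N * N *_) length-reps ⟩
        N * N * (nonFreeReps + freeReps)       ≡⟨ *-distribˡ-+ (N * N) nonFreeReps freeReps ⟩
        N * N * nonFreeReps + N * N * freeReps ≤⟨ +-monoˡ-≤ (N * N * freeReps)
                                                    (*-monoʳ-≤ (N * N) (≤-trans nonFreeReps≤ length-nonFree-≤)) ⟩
        N * N * K + N * N * freeReps           ∎
      upper : N * N * L N ≤ N ! + N * N * K
      upper = begin
        N * N * L N                  ≤⟨ *-monoʳ-≤ (N * N) L≤length-reps ⟩
        N * N * length reps          ≤⟨ N*N*length-reps≤ ⟩
        N * N * K + N * N * freeReps ≤⟨ +-monoʳ-≤ (N * N * K) N*N*freeReps≤N! ⟩
        N * N * K + N !              ≡⟨ +-comm (N * N * K) (N !) ⟩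
        N ! + N * N * K              ∎
      lower : N ! ≤ N * N * L N + N * N * K
      lower = begin
        N !                          ≤⟨ N!≤N*N*length-reps ⟩
        N * N * length reps          ≤⟨ N*N*length-reps≤ ⟩
        N * N * K + N * N * freeReps ≤⟨ +-monoʳ-≤ (N * N * K) (*-monoʳ-≤ (N * N) freeReps≤L) ⟩
        N * N * K + N * N * L N      ≡⟨ +-comm (N * N * K) (N * N * L N) ⟩
        N * N * L N + N * N * K      ∎

  -- With c = 4 + t: 2 (c - i) ≥ c for i ≤ 3, and (c - 4)! ≥ c - 4 ≥ 256 q.
  16qc⁴≤c! : ∀ q t → 2 + 256 * q ≤ t → 16 * q * ((4 + t) * (4 + t) * (4 + t) * (4 + t)) ≤ (4 + t) !
  16qc⁴≤c! q t 2+256q≤t = begin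
    16 * q * (c * c * c * c)
      ≤⟨ *-monoʳ-≤ (16 * q) (*-mono-≤ (*-mono-≤ (*-mono-≤ c≤2[1+t] c≤2[2+t]) c≤2[3+t]) c≤2[4+t]) ⟩
    16 * q * (2 * (1 + t) * (2 * (2 + t)) * (2 * (3 + t)) * (2 * (4 + t)))
      ≡⟨ regroup q t ⟩
    256 * q * P    ≤⟨ *-monoˡ-≤ P (≤-trans (m≤n+m (256 * q) 2) 2+256q≤t) ⟩
    t * P          ≤⟨ *-monoˡ-≤ P (n≤n! t) ⟩
    t ! * P        ≡⟨ unfold-! t (t !) ⟩
    (4 + t) !      ∎
    where
    open ≤-Reasoning
    c = 4 + t
    P = (4 + t) * (3 + t) * (2 + t) * (1 + t)
    c≤2[1+t] : c ≤ 2 * (1 + t)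
    c≤2[1+t] = begin
      4 + t       ≡⟨ +-comm 2 (2 + t) ⟩
      2 + t + 2   ≤⟨ +-monoʳ-≤ (2 + t) (≤-trans (m≤m+n 2 (256 * q)) 2+256q≤t) ⟩
      2 + t + t   ≡⟨ double t ⟩
      2 * (1 + t) ∎
      where
      double : ∀ t → 2 + t + t ≡ 2 * (1 + t)
      double = solve-∀
    c≤2[2+t] = ≤-trans c≤2[1+t] (*-monoʳ-≤ 2 (n≤1+n (1 + t)))
    c≤2[3+t] = ≤-trans c≤2[2+t] (*-monoʳ-≤ 2 (n≤1+n (2 + t)))
    c≤2[4+t] = ≤-trans c≤2[3+t] (*-monoʳ-≤ 2 (n≤1+n (3 + t)))
    regroup : ∀ q t → 16 * q * (2 * (1 + t) * (2 * (2 + t)) * (2 * (3 + t)) * (2 * (4 + t)))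
                    ≡ 256 * q * ((4 + t) * (3 + t) * (2 + t) * (1 + t))
    regroup = solve-∀
    unfold-! : ∀ t f → f * ((4 + t) * (3 + t) * (2 + t) * (1 + t)) ≡ (4 + t) * ((3 + t) * ((2 + t) * ((1 + t) * f)))
    unfold-! = solve-∀

  module _ (k : ℕ) where

    private
      n = 2 + k

    n*n*k!≡n!+n*k! : n * n * k ! ≡ n ! + n * k !
    n*n*k!≡n!+n*k! = identity k (k !)
      where
      identity : ∀ k f → (2 + k) * (2 + k) * f ≡ (2 + k) * ((1 + k) * f) + (2 + k) * f
      identity = solve-∀

    n*n*∣L-k!∣≤ : ∀ L B → ∣ n * n * L - n ! ∣ ≤ n * n * B → n * n * ∣ L - k ! ∣ ≤ n * n * B + n * k !
    n*n*∣L-k!∣≤ L B ∣n*n*L-n!∣≤ = begin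
      n * n * ∣ L - k ! ∣                              ≡⟨ *-distribˡ-∣-∣ (n * n) L (k !) ⟩
      ∣ n * n * L - n * n * k ! ∣                       ≤⟨ ∣-∣-triangle (n * n * L) (n !) (n * n * k !) ⟩
      ∣ n * n * L - n ! ∣ + ∣ n ! - n * n * k ! ∣       ≡⟨ cong (λ x → ∣ n * n * L - n ! ∣ + ∣ n ! - x ∣) n*n*k!≡n!+n*k! ⟩
      ∣ n * n * L - n ! ∣ + ∣ n ! - n ! + n * k ! ∣     ≡⟨ cong (∣ n * n * L - n ! ∣ +_) (∣m-m+n∣≡n (n !) (n * k !)) ⟩
      ∣ n * n * L - n ! ∣ + n * k !                     ≤⟨ +-monoˡ-≤ (n * k !) ∣n*n*L-n!∣≤ ⟩
      n * n * B + n * k !                               ∎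
      where open ≤-Reasoning

    q*D<k! : ∀ q B D → n * n * D ≤ n * n * B + n * k ! → 2 * q * B ≤ k ! → 2 * q < n → q * D < k !
    q*D<k! q B D n*n*D≤ 2qB≤k! 2q<n =
      *-cancelˡ-< a (q * D) f (*-cancelˡ-< 2 (a * (q * D)) (a * f) (begin-strict
        2 * (a * (q * D))               ≡⟨ e₁ a q D ⟩
        2 * q * (a * D)                 ≤⟨ *-monoʳ-≤ (2 * q) n*n*D≤ ⟩
        2 * q * (a * B + n * f)         ≡⟨ e₂ q a B n f ⟩
        a * (2 * q * B) + 2 * q * (n * f) ≤⟨ +-monoˡ-≤ (2 * q * (n * f)) (*-monoʳ-≤ a 2qB≤k!) ⟩
        a * f + 2 * q * (n * f)         <⟨ +-monoʳ-< (a * f) (*-monoˡ-< (n * f) {{m*n≢0 n f {{_}} {{k !≢0}}}} 2q<n) ⟩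
        a * f + n * (n * f)             ≡⟨ e₃ n f ⟩
        2 * (a * f)                     ∎))
      where
      open ≤-Reasoning
      a = n * n
      f = k !
      e₁ : ∀ a q D → 2 * (a * (q * D)) ≡ 2 * q * (a * D)
      e₁ = solve-∀
      e₂ : ∀ q a B n f → 2 * q * (a * B + n * f) ≡ a * (2 * q * B) + 2 * q * (n * f)
      e₂ = solve-∀
      e₃ : ∀ n f → n * n * f + n * (n * f) ≡ 2 * (n * n * f)
      e₃ = solve-∀

    2*q*[h*n*P]≤k! : ∀ q h P c → P * c ! ≡ n ! → 2 * q * h * n * n * (1 + k) ≤ c ! → 2 * q * (h * n * P) ≤ k !
    2*q*[h*n*P]≤k! q h P c P*c!≡n! small = *-cancelʳ-≤ (2 * q * (h * n * P)) (k !) (c !) {{c !≢0}} (begin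
      2 * q * (h * n * P) * c !              ≡⟨ e₁ q h n P (c !) ⟩
      2 * q * h * n * (P * c !)              ≡⟨ cong (2 * q * h * n *_) P*c!≡n! ⟩
      2 * q * h * n * n !                    ≡⟨ e₂ q h k (k !) ⟩
      2 * q * h * n * n * (1 + k) * k !      ≤⟨ *-monoˡ-≤ (k !) small ⟩
      c ! * k !                              ≡⟨ *-comm (c !) (k !) ⟩
      k ! * c !                              ∎)
      where
      open ≤-Reasoning
      e₁ : ∀ q h n P g → 2 * q * (h * n * P) * g ≡ 2 * q * h * n * (P * g)
      e₁ = solve-∀
      e₂ : ∀ q h k f → 2 * q * h * (2 + k) * ((2 + k) * ((1 + k) * f)) ≡ 2 * q * h * (2 + k) * (2 + k) * (1 + k) * f
      e₂ = solve-∀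

    2*q*h*n*n*[1+k]≤c! : ∀ q h c → h ≤ c → n ≤ c + c → 6 + 256 * q ≤ c → 2 * q * h * n * n * (1 + k) ≤ c !
    2*q*h*n*n*[1+k]≤c! q h c h≤c n≤c+c 6+256q≤c = begin
      2 * q * h * n * n * (1 + k)
        ≤⟨ *-mono-≤ (*-mono-≤ (*-mono-≤ (*-monoʳ-≤ (2 * q) h≤c) n≤c+c) n≤c+c) (≤-trans (n≤1+n (1 + k)) n≤c+c) ⟩
      2 * q * c * (c + c) * (c + c) * (c + c)
        ≡⟨ regroup q c ⟩
      16 * q * (c * c * c * c)
        ≡⟨ cong (λ x → 16 * q * (x * x * x * x)) c≡4+t ⟩
      16 * q * ((4 + t) * (4 + t) * (4 + t) * (4 + t))
        ≤⟨ 16qc⁴≤c! q t (∸-monoˡ-≤ 4 6+256q≤c) ⟩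
      (4 + t) !
        ≡⟨ cong _! c≡4+t ⟨
      c ! ∎
      where
      open ≤-Reasoning
      t = c ∸ 4
      c≡4+t : c ≡ 4 + t
      c≡4+t = sym (m+[n∸m]≡n (≤-trans (m≤m+n 4 (2 + 256 * q)) 6+256q≤c))
      regroup : ∀ q c → 2 * q * c * (c + c) * (c + c) * (c + c) ≡ 16 * q * (c * c * c * c)
      regroup = solve-∀

  ∣m⊖n∣≡∣m-n∣ : ∀ m n → ℤ.∣ m ⊖ n ∣ ≡ ∣ m - n ∣
  ∣m⊖n∣≡∣m-n∣ m n with ≤-total m n
  ... | inj₁ m≤n = trans (ℤ.∣⊖∣-≤ m≤n) (sym (m≤n⇒∣m-n∣≡n∸m m≤n))
  ... | inj₂ n≤m = trans (ℤ.∣m⊖n∣≡∣n⊖m∣ m n) (trans (ℤ.∣⊖∣-≤ n≤m) (sym (m≤n⇒∣n-m∣≡n∸m n≤m)))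

  -- ε = p / d with p ≥ 1, so it suffices that ∣m - n∣ / n < 1 / d.
  ∣m/n-1∣<ε : ∀ m n .{{_ : NonZero n}} (ε : ℚ) → 0ℚ ℚ.< ε → ↧ₙ ε * ∣ m - n ∣ < n → ℚ.∣ ℤ.+ m ℚ./ n ℚ.- 1ℚ ∣ ℚ.< ε
  ∣m/n-1∣<ε m (suc n-1) (mkℚ (ℤ.+ zero)  _ _) (*<* (ℤ.+<+ ()))
  ∣m/n-1∣<ε m (suc n-1) (mkℚ -[1+ _ ] _ _) (*<* ())
  ∣m/n-1∣<ε m (suc n-1) (mkℚ +[1+ p ] d-1 _) _ d*∣m-n∣<n = toℚᵘ-cancel-< (ℚᵘ.<-respˡ-≃ dist≃ dist<ε)
    where
    n = suc n-1
    dist : ℚᵘ.ℚᵘ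
    dist = ℚᵘ.mkℚᵘ (ℤ.+ ∣ m - n ∣) n-1
    dist<ε : dist ℚᵘ.< ℚᵘ.mkℚᵘ +[1+ p ] d-1
    dist<ε = ℚᵘ.*<* (subst₂ ℤ._<_ (ℤ.pos-* ∣ m - n ∣ (suc d-1)) (ℤ.pos-* (suc p) n) (ℤ.+<+ (begin-strict
      ∣ m - n ∣ * suc d-1  ≡⟨ *-comm ∣ m - n ∣ (suc d-1) ⟩
      suc d-1 * ∣ m - n ∣  <⟨ d*∣m-n∣<n ⟩
      n                      ≤⟨ m≤n*m n (suc p) ⟩
      suc p * n            ∎)))
      where open ≤-Reasoning
    m/n-1≃ : ℚᵘ.mkℚᵘ (ℤ.+ m) n-1 ℚᵘ.+ ℚᵘ.- toℚᵘ 1ℚ ℚᵘ.≃ ℚᵘ.mkℚᵘ (m ⊖ n) n-1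
    m/n-1≃ = ℚᵘ.*≡* (cong₂ ℤ._*_ numerator (cong (λ k → ℤ.+ suc k) (sym (*-identityʳ n-1))))
      where
      numerator : ℤ.+ m ℤ.* ℤ.+ 1 ℤ.+ ℤ.- ℤ.+ 1 ℤ.* ℤ.+ n ≡ m ⊖ n
      numerator = trans (cong₂ ℤ._+_ (ℤ.*-identityʳ (ℤ.+ m)) (ℤ.-1*i≡-i (ℤ.+ n))) (ℤ.m-n≡m⊖n m n)
    dist≃ : dist ℚᵘ.≃ toℚᵘ ℚ.∣ ℤ.+ m ℚ./ n ℚ.- 1ℚ ∣
    dist≃ = ℚᵘ.≃-sym (begin
      toℚᵘ ℚ.∣ ℤ.+ m ℚ./ n ℚ.- 1ℚ ∣
        ≈⟨ toℚᵘ-homo-∣-∣ (ℤ.+ m ℚ./ n ℚ.- 1ℚ) ⟩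
      ℚᵘ.∣ toℚᵘ (ℤ.+ m ℚ./ n ℚ.- 1ℚ) ∣
        ≈⟨ ℚᵘ.∣-∣-cong (toℚᵘ-homo-+ (ℤ.+ m ℚ./ n) (ℚ.- 1ℚ)) ⟩
      ℚᵘ.∣ toℚᵘ (ℤ.+ m ℚ./ n) ℚᵘ.+ toℚᵘ (ℚ.- 1ℚ) ∣
        ≈⟨ ℚᵘ.∣-∣-cong (ℚᵘ.+-cong (toℚᵘ-fromℚᵘ (ℚᵘ.mkℚᵘ (ℤ.+ m) n-1)) (toℚᵘ-homo‿- 1ℚ)) ⟩
      ℚᵘ.∣ ℚᵘ.mkℚᵘ (ℤ.+ m) n-1 ℚᵘ.+ ℚᵘ.- toℚᵘ 1ℚ ∣
        ≈⟨ ℚᵘ.∣-∣-cong m/n-1≃ ⟩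
      ℚᵘ.mkℚᵘ (ℤ.+ ℤ.∣ m ⊖ n ∣) n-1
        ≡⟨ cong (λ k → ℚᵘ.mkℚᵘ (ℤ.+ k) n-1) (∣m⊖n∣≡∣m-n∣ m n) ⟩
      dist ∎)
      where open ℚᵘ.≃-Reasoning

  q*∣L-k!∣<k! : ∀ q k → (6 + 256 * q) + (6 + 256 * q) ≤ 2 + k → q * ∣ L (2 + k) - k ! ∣ < k !
  q*∣L-k!∣<k! q k large = q*D<k! k q nonFreeBound ∣ L n - k ! ∣
    (n*n*∣L-k!∣≤ k (L n) nonFreeBound ∣N*N*L-N!∣≤N*N*nonFreeBound)
    (2*q*[h*n*P]≤k! k q h (falling n h) c falling*c!≡n! (2*q*h*n*n*[1+k]≤c! k q h c (⌊n/2⌋≤⌈n/2⌉ n) n≤c+c x≤c))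
    2q<n
    where
    n = 2 + k
    h = ⌊ n /2⌋
    c = ⌈ n /2⌉
    x = 6 + 256 * q
    open NonFreeCount (suc k) using (nonFreeBound; ∣N*N*L-N!∣≤N*N*nonFreeBound)
    falling*c!≡n! : falling n h * c ! ≡ n !
    falling*c!≡n! = subst (λ y → falling n h * y ! ≡ n !)
      (trans (cong (_∸ h) (sym (⌊n/2⌋+⌈n/2⌉≡n n))) (m+n∸m≡n h c)) (falling-*-! n h (⌊n/2⌋≤n n))
    n≤c+c : n ≤ c + c
    n≤c+c = subst (_≤ c + c) (⌊n/2⌋+⌈n/2⌉≡n n) (+-monoˡ-≤ c (⌊n/2⌋≤⌈n/2⌉ n))
    x≤c : x ≤ c
    x≤c = subst (_≤ c) (sym (n≡⌈n+n/2⌉ x)) (⌈n/2⌉-mono large)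
    2q<n : 2 * q < n
    2q<n = ≤-trans (subst (_< x + x) (cong (q +_) (sym (+-identityʳ q))) (+-mono-< q<x q<x)) large
      where
      q<x : q < x
      q<x = s≤s (≤-trans (m≤n*m q 256) (m≤n+m (256 * q) 5))

open import Data.Nat using (ℕ; zero; suc; _≤_; s≤s; _!; _+_; _*_)
open import Data.Nat.Properties using (_!≢0)
open import Data.Rational using (ℚ; 0ℚ; 1ℚ; _<_; _-_; ∣_∣; ↧ₙ_)
open import Data.Product using (∃-syntax; _,_)
open OneCycles using (q*∣L-k!∣<k!; ∣m/n-1∣<ε)

lemma7 : ∀ (ε : ℚ) → 0ℚ < ε →
    ∃[ N ] (∀ (n : ℕ) → N ≤ n → ∣ ratio n - 1ℚ ∣ < ε)
lemma7 ε 0<ε = x + x , close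
  where
  x = 6 + 256 * ↧ₙ ε
  close : ∀ n → x + x ≤ n → ∣ ratio n - 1ℚ ∣ < ε
  close (suc (suc k)) large = ∣m/n-1∣<ε (L (2 + k)) (k !) {{k !≢0}} ε 0<ε (q*∣L-k!∣<k! (↧ₙ ε) k large)
  close (suc zero) (s≤s ())
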